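{- Let $k\ge1$ be an integer and $C_k=\frac{1}{k+1}\binom{2k}{k}$ the $k$-th Catalan number. If $\alpha(J(2k,k)) = C_k$, then $k+1$ is prime.
   Context: For integers $0<k<N$, the Johnson graph $J(N,k)$ has as vertices the $k$-element subsets of $\{1,\dots,N\}$, two being adjacent iff they share exactly $k-1$ elements. $\alpha(G)$ denotes the independence number of a graph $G$. -}

module Defs where

open import Data.Nat using (ℕ; suc; _≤_; _∸_; _*_; _/_)
open import Data.Nat.Combinatorics using (_C_)
open import Data.Fin.Subset using (Subset; ∣_∣; _∩_)
open import Data.List using (List; length)
open import Data.List.Membership.Propositional using (_∈_)
open import Data.List.Relation.Unary.All using (All)
open import Data.List.Relation.Unary.Unique.Propositional using (Unique)
open import Data.Product using (Σ; _×_)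
open import Relation.Binary.PropositionalEquality using (_≡_; _≢_)
open import Relation.Nullary using (¬_)

-- k-th Catalan number C_k = (2k choose k) / (k+1)  (exact division)
catalan : ℕ → ℕ
catalan k = ((2 * k) C k) / suc k

IsVertex : (N k : ℕ) → Subset N → Set
IsVertex N k s = ∣ s ∣ ≡ k

Adjacent : (N k : ℕ) → Subset N → Subset N → Set
Adjacent N k s t = ∣ s ∩ t ∣ ≡ k ∸ 1

IsIndependentSet : (N k : ℕ) → List (Subset N) → Set
IsIndependentSet N k I =
  Unique I × All (IsVertex N k) I ×
  (∀ {s t} → s ∈ I → t ∈ I → ¬ Adjacent N k s t)

IndependenceNumberIs : (N k m : ℕ) → Set
IndependenceNumberIs N k m =
  Σ (List (Subset N)) (λ I → IsIndependentSet N k I × length I ≡ m) ×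
  (∀ I → IsIndependentSet N k I → length I ≤ m)

-- Let I be an independent set of k-sets in J(2k,k) with |I| = C_k, so k |I| = C(2k,k-1).
-- Two members of I containing a common (k-1)-set would share k-1 elements, so each
-- (k-1)-set lies in at most one member; as the members contain k |I| = C(2k,k-1)
-- (k-1)-sets in total, each lies in exactly one, i.e. I is a Steiner system
-- S(k-1,k,2k). Counting, for a fixed i-set T, the (k-1)-sets containing T in two ways
-- gives (j+1) ∣ C(2k-i, j) whenever i + j = k-1. If a prime p = j+1 ≤ k divided
-- k+1 = qp, the choice i = k-1-j gives 2k-i = qp + j, but p ∤ C(qp+j, j) by Lucas.
module Submission where

open import Defs
open import Data.Bool.Base using (if_then_else_)
open import Data.Empty using (⊥-elim)
open import Data.Fin.Subset using (Subset; inside; outside; ⊤; ⊥; _∩_; _─_; ∣_∣; _⊆_)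
open import Data.Fin.Subset.Properties
  using (_⊆?_; ⊆⊤; ⊥⊆; ∣⊤∣≡n; ∣⊥∣≡0; p─⊥≡p; drop-∷-⊆; p⊆q⇒∣p∣≤∣q∣;
         p∩q⊆p; p∩q⊆q; ∣p∩q∣≤∣p∣; x∈p∩q⁺)
open import Data.List using (List; []; _∷_; length)
open import Data.List.Membership.Propositional using (_∈_)
open import Data.List.Relation.Unary.All using (All; _∷_)
import Data.List.Relation.Unary.All as All
open import Data.List.Relation.Unary.AllPairs using (_∷_)
open import Data.List.Relation.Unary.Any using (here; there)
open import Data.List.Relation.Unary.Unique.Propositional using (Unique)
open import Data.Nat
  using (ℕ; zero; suc; _+_; _*_; _∸_; _≤_; _<_; z≤n; s≤s; s≤s⁻¹;
         NonTrivial; nonTrivial⇒nonZero; nonTrivial⇒≢1)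
open import Data.Nat.Combinatorics using (_C_; nC1≡n; nCk≡nC[n∸k]; nCk+nC[k+1]≡[n+1]C[k+1])
open import Data.Nat.Divisibility
  using (_∣_; _∤_; divides; ∣-trans; ∣⇒≤; ∣1⇒≡1; ∣m+n∣m⇒∣n; n∣m*n; m∣m*n)
open import Data.Nat.DivMod using (_/_; m*n/n≡m)
open import Data.Nat.ListAction using (product)
open import Data.Nat.Primality
  using (Prime; prime?; euclidsLemma; ¬prime[0]; ¬prime[1]; ¬prime⇒composite; composite)
open import Data.Nat.Primality.Factorisation using (factorise)
open import Data.Nat.Properties
open import Data.Product using (_×_; _,_; ∃; ∃-syntax; proj₁; proj₂)
open import Data.Sum using (inj₁; inj₂; [_,_]′)
open import Data.Vec using ([]; _∷_; here)
open import Function using (_∘_)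
open import Relation.Binary.PropositionalEquality
open import Relation.Nullary using (Dec; yes; no; does; ¬_; contradiction; _×-dec_)
open import Relation.Nullary.Decidable using (dec-true; dec-false)
open ≡-Reasoning
open import Algebra.Properties.CommutativeSemigroup +-commutativeSemigroup
  using () renaming (interchange to +-interchange)

[1+k]*[1+n]C[1+k]≡[1+n]*nCk : ∀ n k → suc k * (suc n C suc k) ≡ suc n * (n C k)
[1+k]*[1+n]C[1+k]≡[1+n]*nCk zero    zero    = refl
[1+k]*[1+n]C[1+k]≡[1+n]*nCk zero    (suc k) = *-zeroʳ (suc (suc k))
[1+k]*[1+n]C[1+k]≡[1+n]*nCk (suc n) zero    =
  trans (*-identityˡ _) (trans (nC1≡n (suc (suc n))) (sym (*-identityʳ _)))
[1+k]*[1+n]C[1+k]≡[1+n]*nCk (suc n) (suc k) = begin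
  suc (suc k) * (suc (suc n) C suc (suc k))
    ≡⟨ cong (suc (suc k) *_) (sym (nCk+nC[k+1]≡[n+1]C[k+1] (suc n) (suc k))) ⟩
  suc (suc k) * (a + b)
    ≡⟨ *-distribˡ-+ (suc (suc k)) a b ⟩
  (a + suc k * a) + suc (suc k) * b
    ≡⟨ cong₂ (λ x y → (a + x) + y) ([1+k]*[1+n]C[1+k]≡[1+n]*nCk n k)
                                   ([1+k]*[1+n]C[1+k]≡[1+n]*nCk n (suc k)) ⟩
  (a + suc n * (n C k)) + suc n * (n C suc k)
    ≡⟨ +-assoc a _ _ ⟩
  a + (suc n * (n C k) + suc n * (n C suc k))
    ≡⟨ cong (a +_) (sym (*-distribˡ-+ (suc n) (n C k) _)) ⟩
  a + suc n * (n C k + n C suc k)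
    ≡⟨ cong (λ x → a + suc n * x) (nCk+nC[k+1]≡[n+1]C[k+1] n k) ⟩
  suc (suc n) * (suc n C suc k) ∎
  where
  a b : ℕ
  a = suc n C suc k
  b = suc n C suc (suc k)

[m+n]Cm≡[m+n]Cn : ∀ m n → (m + n) C m ≡ (m + n) C n
[m+n]Cm≡[m+n]Cn m n =
  trans (nCk≡nC[n∸k] (m≤m+n m n)) (cong ((m + n) C_) (m+n∸m≡n m n))

[1+n]Cn≡1+n : ∀ n → suc n C n ≡ suc n
[1+n]Cn≡1+n n = begin
  suc n C n      ≡⟨ cong (_C n) (+-comm 1 n) ⟩
  (n + 1) C n    ≡⟨ [m+n]Cm≡[m+n]Cn n 1 ⟩
  (n + 1) C 1    ≡⟨ nC1≡n (n + 1) ⟩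
  n + 1          ≡⟨ +-comm n 1 ⟩
  suc n          ∎

[1+r]*[1+m+r]C[1+r]≡[1+m]*[1+m+r]Cr :
  ∀ m r → suc r * (suc (m + r) C suc r) ≡ suc m * (suc (m + r) C r)
[1+r]*[1+m+r]C[1+r]≡[1+m]*[1+m+r]Cr m r = begin
  suc r * (suc (m + r) C suc r)  ≡⟨ [1+k]*[1+n]C[1+k]≡[1+n]*nCk (m + r) r ⟩
  suc (m + r) * ((m + r) C r)    ≡⟨ cong (suc (m + r) *_) ([m+n]Cm≡[m+n]Cn m r) ⟨
  suc (m + r) * ((m + r) C m)    ≡⟨ [1+k]*[1+n]C[1+k]≡[1+n]*nCk (m + r) m ⟨
  suc m * (suc (m + r) C suc m)  ≡⟨ cong (suc m *_) ([m+n]Cm≡[m+n]Cn (suc m) r) ⟩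
  suc m * (suc (m + r) C r)      ∎

-- K X = (K+1) Y gives X = (K+1)(X ∸ Y), so the division defining catalan K is exact.
[1+k]*catalan[1+k]≡2[1+k]Ck : ∀ k → suc k * catalan (suc k) ≡ (2 * suc k) C k
[1+k]*catalan[1+k]≡2[1+k]Ck k = begin
  K * catalan K      ≡⟨ cong (K *_) catalan-K≡X∸Y ⟩
  K * (X ∸ Y)        ≡⟨ *-distribˡ-∸ K X Y ⟩
  K * X ∸ K * Y      ≡⟨ cong (_∸ K * Y) KX≡[1+K]Y ⟩
  Y + K * Y ∸ K * Y  ≡⟨ m+n∸n≡m Y (K * Y) ⟩
  Y                  ∎
  where
  K X Y : ℕ
  K = suc k
  X = (2 * K) C K
  Y = (2 * K) C k

  KX≡[1+K]Y : K * X ≡ suc K * Y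
  KX≡[1+K]Y = subst (λ n → K * (n C K) ≡ suc K * (n C k)) (sym 2K≡1+K+k)
    ([1+r]*[1+m+r]C[1+r]≡[1+m]*[1+m+r]Cr K k)
    where
    2K≡1+K+k : 2 * K ≡ suc (K + k)
    2K≡1+K+k = cong suc (trans (cong (k +_) (+-identityʳ K)) (+-suc k k))

  X≡[1+K][X∸Y] : X ≡ suc K * (X ∸ Y)
  X≡[1+K][X∸Y] = begin
    X                          ≡⟨ m+n∸n≡m X (K * X) ⟨
    X + K * X ∸ K * X          ≡⟨ cong (suc K * X ∸_) KX≡[1+K]Y ⟩
    suc K * X ∸ suc K * Y      ≡⟨ *-distribˡ-∸ (suc K) X Y ⟨
    suc K * (X ∸ Y)            ∎

  catalan-K≡X∸Y : catalan K ≡ X ∸ Y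
  catalan-K≡X∸Y = trans (cong (_/ suc K) (trans X≡[1+K][X∸Y] (*-comm (suc K) (X ∸ Y))))
                        (m*n/n≡m (X ∸ Y) (suc K))

-- Lucas' theorem in its simplest instance.
p∤[qp+r]Cr : ∀ {p} → Prime p → ∀ q {r} → r < p → p ∤ (q * p + r) C r
p∤[qp+r]Cr {p} p-prime q {zero} _ p∣1 = ¬prime[1] (subst Prime (∣1⇒≡1 p∣1) p-prime)
p∤[qp+r]Cr {p} p-prime q {suc r} 1+r<p p∣C
  with euclidsLemma (suc (q * p + r)) ((q * p + r) C r) p-prime p∣product
  where
  p∣product : p ∣ suc (q * p + r) * ((q * p + r) C r)
  p∣product = subst (p ∣_) ([1+k]*[1+n]C[1+k]≡[1+n]*nCk (q * p + r) r)
    (∣-trans (subst (λ n → p ∣ n C suc r) (+-suc (q * p) r) p∣C) (n∣m*n (suc r)))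
... | inj₁ p∣qp+1+r = <⇒≱ 1+r<p
  (∣⇒≤ (∣m+n∣m⇒∣n (subst (p ∣_) (sym (+-suc (q * p) r)) p∣qp+1+r) (n∣m*n q)))
... | inj₂ p∣C′ = p∤[qp+r]Cr p-prime q (<-trans (n<1+n r) 1+r<p) p∣C′

prime-factor : ∀ n .{{_ : NonTrivial n}} → ∃[ p ] Prime p × p ∣ n
prime-factor n with factorise n {{nonTrivial⇒nonZero n}}
... | record { factors = [] ; isFactorisation = n≡1 } = contradiction n≡1 (nonTrivial⇒≢1 {n})
... | record { factors = p ∷ ps ; isFactorisation = n≡p*∏ps ; factorsPrime = p-prime ∷ _ } =
  p , p-prime , subst (p ∣_) (sym n≡p*∏ps) (m∣m*n (product ps))

¬prime⇒prime-divisor< : ∀ {n} .{{_ : NonTrivial n}} → ¬ Prime n → ∃[ p ] Prime p × p < n × p ∣ n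
¬prime⇒prime-divisor< ¬prime with ¬prime⇒composite ¬prime
... | composite {d} d<n d∣n with prime-factor d
...   | p , p-prime , p∣d =
  p , p-prime , ≤-<-trans (∣⇒≤ {{nonTrivial⇒nonZero d}} p∣d) d<n , ∣-trans p∣d d∣n

𝟙[_] : ∀ {a} {A : Set a} → Dec A → ℕ
𝟙[ a? ] = if does a? then 1 else 0

module _ {a} {A : Set a} where

  𝟙-yes : (a? : Dec A) → A → 𝟙[ a? ] ≡ 1
  𝟙-yes a? a rewrite dec-true a? a = refl

  𝟙-no : (a? : Dec A) → ¬ A → 𝟙[ a? ] ≡ 0
  𝟙-no a? ¬a rewrite dec-false a? ¬a = refl

  𝟙[a]*x≤𝟙[a] : (a? : Dec A) {x : ℕ} → (A → x ≤ 1) → 𝟙[ a? ] * x ≤ 𝟙[ a? ]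
  𝟙[a]*x≤𝟙[a] (yes a) x≤1 = subst (_≤ 1) (sym (+-identityʳ _)) (x≤1 a)
  𝟙[a]*x≤𝟙[a] (no _)  _   = z≤n

  𝟙[a]*x≡𝟙[a] : (a? : Dec A) {x : ℕ} → (A → x ≡ 1) → 𝟙[ a? ] * x ≡ 𝟙[ a? ]
  𝟙[a]*x≡𝟙[a] (yes a) x≡1 = trans (+-identityʳ _) (x≡1 a)
  𝟙[a]*x≡𝟙[a] (no _)  _   = refl

module _ {a b} {A : Set a} {B : Set b} where

  𝟙-×-dec-yes : (a? : Dec A) (b? : Dec B) → A → 𝟙[ a? ×-dec b? ] ≡ 𝟙[ b? ]
  𝟙-×-dec-yes a? b? a rewrite dec-true a? a = refl

  𝟙[×-dec]≡𝟙*𝟙 : (a? : Dec A) (b? : Dec B) → 𝟙[ a? ×-dec b? ] ≡ 𝟙[ a? ] * 𝟙[ b? ]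
  𝟙[×-dec]≡𝟙*𝟙 (yes _) (yes _) = refl
  𝟙[×-dec]≡𝟙*𝟙 (yes _) (no _)  = refl
  𝟙[×-dec]≡𝟙*𝟙 (no _)  _       = refl

∑ : ∀ {n} → (Subset n → ℕ) → ℕ
∑ {zero}  f = f []
∑ {suc n} f = ∑ (λ A → f (outside ∷ A)) + ∑ (λ A → f (inside ∷ A))

∑-cong : ∀ {n} {f g : Subset n → ℕ} → (∀ A → f A ≡ g A) → ∑ f ≡ ∑ g
∑-cong {zero}  f≗g = f≗g []
∑-cong {suc n} f≗g =
  cong₂ _+_ (∑-cong (λ A → f≗g (outside ∷ A))) (∑-cong (λ A → f≗g (inside ∷ A)))

∑-≡0 : ∀ {n} {f : Subset n → ℕ} → (∀ A → f A ≡ 0) → ∑ f ≡ 0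
∑-≡0 {zero}  f≗0 = f≗0 []
∑-≡0 {suc n} f≗0 =
  cong₂ _+_ (∑-≡0 (λ A → f≗0 (outside ∷ A))) (∑-≡0 (λ A → f≗0 (inside ∷ A)))

∑-distrib-+ : ∀ {n} (f g : Subset n → ℕ) → ∑ (λ A → f A + g A) ≡ ∑ f + ∑ g
∑-distrib-+ {zero}  f g = refl
∑-distrib-+ {suc n} f g = begin
  ∑ (λ A → f₀ A + g₀ A) + ∑ (λ A → f₁ A + g₁ A)
    ≡⟨ cong₂ _+_ (∑-distrib-+ f₀ g₀) (∑-distrib-+ f₁ g₁) ⟩
  (∑ f₀ + ∑ g₀) + (∑ f₁ + ∑ g₁)
    ≡⟨ +-interchange (∑ f₀) (∑ g₀) (∑ f₁) (∑ g₁) ⟩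
  (∑ f₀ + ∑ f₁) + (∑ g₀ + ∑ g₁) ∎
  where
  f₀ f₁ g₀ g₁ : Subset n → ℕ
  f₀ A = f (outside ∷ A)
  f₁ A = f (inside ∷ A)
  g₀ A = g (outside ∷ A)
  g₁ A = g (inside ∷ A)

∑-mono-≤ : ∀ {n} {f g : Subset n → ℕ} → (∀ A → f A ≤ g A) → ∑ f ≤ ∑ g
∑-mono-≤ {zero}  f≤g = f≤g []
∑-mono-≤ {suc n} f≤g =
  +-mono-≤ (∑-mono-≤ (λ A → f≤g (outside ∷ A))) (∑-mono-≤ (λ A → f≤g (inside ∷ A)))

+-mono-≤-≡⇒≡ : ∀ {m n o p} → m ≤ o → n ≤ p → m + n ≡ o + p → m ≡ o × n ≡ p
+-mono-≤-≡⇒≡ {m} m≤o n≤p eq with m≤n⇒m<n∨m≡n m≤o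
... | inj₂ refl = refl , +-cancelˡ-≡ m _ _ eq
... | inj₁ m<o  = contradiction eq (<⇒≢ (+-mono-<-≤ m<o n≤p))

pointwise≤∧∑≡⇒≡ : ∀ {n} {f g : Subset n → ℕ} → (∀ A → f A ≤ g A) → ∑ f ≡ ∑ g → ∀ A → f A ≡ g A
pointwise≤∧∑≡⇒≡ {zero}  _   ∑f≡∑g [] = ∑f≡∑g
pointwise≤∧∑≡⇒≡ {suc n} f≤g ∑f≡∑g (x ∷ A)
  with +-mono-≤-≡⇒≡ (∑-mono-≤ (λ A → f≤g (outside ∷ A))) (∑-mono-≤ (λ A → f≤g (inside ∷ A))) ∑f≡∑g
     | x
... | ∑₀≡ , _ | outside = pointwise≤∧∑≡⇒≡ (λ A → f≤g (outside ∷ A)) ∑₀≡ A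
... | _ , ∑₁≡ | inside  = pointwise≤∧∑≡⇒≡ (λ A → f≤g (inside ∷ A)) ∑₁≡ A

∑ᴸ : ∀ {a} {X : Set a} → List X → (X → ℕ) → ℕ
∑ᴸ []       f = 0
∑ᴸ (x ∷ xs) f = f x + ∑ᴸ xs f

module _ {a} {X : Set a} where

  ∑ᴸ-cong : ∀ (xs : List X) {f g : X → ℕ} → (∀ {x} → x ∈ xs → f x ≡ g x) → ∑ᴸ xs f ≡ ∑ᴸ xs g
  ∑ᴸ-cong []       _   = refl
  ∑ᴸ-cong (x ∷ xs) f≗g = cong₂ _+_ (f≗g (here refl)) (∑ᴸ-cong xs (f≗g ∘ there))

  ∑ᴸ-const : ∀ (xs : List X) c → ∑ᴸ xs (λ _ → c) ≡ length xs * c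
  ∑ᴸ-const []       c = refl
  ∑ᴸ-const (x ∷ xs) c = cong (c +_) (∑ᴸ-const xs c)

  ∑ᴸ-distribˡ-* : ∀ (xs : List X) c f → c * ∑ᴸ xs f ≡ ∑ᴸ xs (λ x → c * f x)
  ∑ᴸ-distribˡ-* []       c f = *-zeroʳ c
  ∑ᴸ-distribˡ-* (x ∷ xs) c f =
    trans (*-distribˡ-+ c (f x) _) (cong (c * f x +_) (∑ᴸ-distribˡ-* xs c f))

  ∑-∑ᴸ-comm : ∀ {n} (xs : List X) (h : Subset n → X → ℕ) →
    ∑ (λ A → ∑ᴸ xs (h A)) ≡ ∑ᴸ xs (λ x → ∑ (λ A → h A x))
  ∑-∑ᴸ-comm {n} []       h = ∑-≡0 {n} (λ _ → refl)
  ∑-∑ᴸ-comm {n} (x ∷ xs) h =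
    trans (∑-distrib-+ (λ A → h A x) (λ A → ∑ᴸ xs (h A)))
          (cong (∑ (λ A → h A x) +_) (∑-∑ᴸ-comm xs h))

  ∑ᴸ-𝟙≤1 : ∀ {p} {P : X → Set p} (P? : ∀ x → Dec (P x)) {xs : List X} → Unique xs →
    (∀ {x y} → x ∈ xs → y ∈ xs → P x → P y → x ≡ y) → ∑ᴸ xs (λ x → 𝟙[ P? x ]) ≤ 1
  ∑ᴸ-𝟙≤1 P? {[]}     _                  _        = z≤n
  ∑ᴸ-𝟙≤1 {P = P} P? {x ∷ xs} (x∉xs ∷ unique-xs) P-unique with P? x
  ... | no _   = ∑ᴸ-𝟙≤1 P? unique-xs (λ y∈xs z∈xs → P-unique (there y∈xs) (there z∈xs))
  ... | yes Px = ≤-reflexive (cong suc (begin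
    ∑ᴸ xs (λ y → 𝟙[ P? y ])  ≡⟨ ∑ᴸ-cong xs (λ {y} y∈xs → 𝟙-no (P? y) (¬P y∈xs)) ⟩
    ∑ᴸ xs (λ _ → 0)          ≡⟨ ∑ᴸ-const xs 0 ⟩
    length xs * 0            ≡⟨ *-zeroʳ (length xs) ⟩
    0                        ∎))
    where
    ¬P : ∀ {y} → y ∈ xs → ¬ P y
    ¬P y∈xs Py = All.lookup x∉xs y∈xs (P-unique (here refl) (there y∈xs) Px Py)

inside∷p⊈outside∷q : ∀ {n} {p q : Subset n} → ¬ (inside ∷ p ⊆ outside ∷ q)
inside∷p⊈outside∷q p⊆q = contradiction (p⊆q here) λ ()

p⊆q⇒∣q∣≡∣p∣+∣q─p∣ : ∀ {n} {p q : Subset n} → p ⊆ q → ∣ q ∣ ≡ ∣ p ∣ + ∣ q ─ p ∣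
p⊆q⇒∣q∣≡∣p∣+∣q─p∣ {p = []}          {[]}          _   = refl
p⊆q⇒∣q∣≡∣p∣+∣q─p∣ {p = outside ∷ p} {outside ∷ q} p⊆q = p⊆q⇒∣q∣≡∣p∣+∣q─p∣ (drop-∷-⊆ p⊆q)
p⊆q⇒∣q∣≡∣p∣+∣q─p∣ {p = outside ∷ p} {inside ∷ q}  p⊆q =
  trans (cong suc (p⊆q⇒∣q∣≡∣p∣+∣q─p∣ (drop-∷-⊆ p⊆q))) (sym (+-suc ∣ p ∣ ∣ q ─ p ∣))
p⊆q⇒∣q∣≡∣p∣+∣q─p∣ {p = inside ∷ p}  {outside ∷ q} p⊆q = ⊥-elim (inside∷p⊈outside∷q p⊆q)
p⊆q⇒∣q∣≡∣p∣+∣q─p∣ {p = inside ∷ p}  {inside ∷ q}  p⊆q = cong suc (p⊆q⇒∣q∣≡∣p∣+∣q─p∣ (drop-∷-⊆ p⊆q))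

p⊆q⇒∣p∣≡∣q∣⇒p≡q : ∀ {n} {p q : Subset n} → p ⊆ q → ∣ p ∣ ≡ ∣ q ∣ → p ≡ q
p⊆q⇒∣p∣≡∣q∣⇒p≡q {p = []}          {[]}          _   _  = refl
p⊆q⇒∣p∣≡∣q∣⇒p≡q {p = outside ∷ p} {outside ∷ q} p⊆q eq =
  cong (outside ∷_) (p⊆q⇒∣p∣≡∣q∣⇒p≡q (drop-∷-⊆ p⊆q) eq)
p⊆q⇒∣p∣≡∣q∣⇒p≡q {p = outside ∷ p} {inside ∷ q}  p⊆q eq =
  contradiction eq (<⇒≢ (s≤s (p⊆q⇒∣p∣≤∣q∣ (drop-∷-⊆ p⊆q))))
p⊆q⇒∣p∣≡∣q∣⇒p≡q {p = inside ∷ p}  {outside ∷ q} p⊆q _  = ⊥-elim (inside∷p⊈outside∷q p⊆q)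
p⊆q⇒∣p∣≡∣q∣⇒p≡q {p = inside ∷ p}  {inside ∷ q}  p⊆q eq =
  cong (inside ∷_) (p⊆q⇒∣p∣≡∣q∣⇒p≡q (drop-∷-⊆ p⊆q) (suc-injective eq))

subset-of-size : ∀ {i n} → i ≤ n → ∃ λ (T : Subset n) → ∣ T ∣ ≡ i
subset-of-size {n = n} z≤n = ⊥ , ∣⊥∣≡0 n
subset-of-size (s≤s i≤n) with subset-of-size i≤n
... | T , ∣T∣≡i = inside ∷ T , cong suc ∣T∣≡i

Extends : ∀ {n} → Subset n → ℕ → Subset n → Set
Extends T j A = T ⊆ A × ∣ A ─ T ∣ ≡ j

extends? : ∀ {n} (T : Subset n) j A → Dec (Extends T j A)
extends? T j A = T ⊆? A ×-dec ∣ A ─ T ∣ ≟ j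

private
  inside∷T⊈outside∷A⇒𝟙≡0 : ∀ {n} {T : Subset n} B j A →
    𝟙[ outside ∷ A ⊆? B ×-dec extends? (inside ∷ T) j (outside ∷ A) ] ≡ 0
  inside∷T⊈outside∷A⇒𝟙≡0 {T = T} B j A =
    𝟙-no (outside ∷ A ⊆? B ×-dec extends? (inside ∷ T) j (outside ∷ A))
      λ (_ , T⊆A , _) → inside∷p⊈outside∷q T⊆A

∑-extends-within : ∀ {n} (T B : Subset n) j →
  ∑ (λ A → 𝟙[ A ⊆? B ×-dec extends? T j A ]) ≡ 𝟙[ T ⊆? B ] * (∣ B ─ T ∣ C j)
∑-extends-within []            []           zero    = refl
∑-extends-within []            []           (suc j) = refl
∑-extends-within {suc n} (outside ∷ T) (outside ∷ B) j =
  trans (cong₂ _+_ (∑-extends-within T B j) (∑-≡0 {n} (λ _ → refl))) (+-identityʳ _)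
∑-extends-within (outside ∷ T) (inside ∷ B) zero =
  trans (cong₂ _+_ (∑-extends-within T B zero) (∑-≡0 too-large)) (+-identityʳ _)
  where
  too-large : ∀ A → 𝟙[ inside ∷ A ⊆? inside ∷ B ×-dec extends? (outside ∷ T) zero (inside ∷ A) ] ≡ 0
  too-large A = 𝟙-no (inside ∷ A ⊆? inside ∷ B ×-dec extends? (outside ∷ T) zero (inside ∷ A))
                     λ { (_ , _ , ()) }
∑-extends-within (outside ∷ T) (inside ∷ B) (suc j) = begin
  ∑ (λ A → 𝟙[ A ⊆? B ×-dec extends? T (suc j) A ]) + ∑ (λ A → 𝟙[ A ⊆? B ×-dec extends? T j A ])
    ≡⟨ cong₂ _+_ (∑-extends-within T B (suc j)) (∑-extends-within T B j) ⟩
  𝟙[T⊆B] * (d C suc j) + 𝟙[T⊆B] * (d C j)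
    ≡⟨ *-distribˡ-+ 𝟙[T⊆B] (d C suc j) (d C j) ⟨
  𝟙[T⊆B] * (d C suc j + d C j)
    ≡⟨ cong (𝟙[T⊆B] *_) (trans (+-comm (d C suc j) (d C j)) (nCk+nC[k+1]≡[n+1]C[k+1] d j)) ⟩
  𝟙[T⊆B] * (suc d C suc j) ∎
  where
  𝟙[T⊆B] d : ℕ
  𝟙[T⊆B] = 𝟙[ T ⊆? B ]
  d = ∣ B ─ T ∣
∑-extends-within {suc n} (inside ∷ T) (outside ∷ B) j =
  cong₂ _+_ (∑-≡0 (inside∷T⊈outside∷A⇒𝟙≡0 {T = T} (outside ∷ B) j)) (∑-≡0 {n} (λ _ → refl))
∑-extends-within (inside ∷ T) (inside ∷ B) j =
  cong₂ _+_ (∑-≡0 (inside∷T⊈outside∷A⇒𝟙≡0 {T = T} (inside ∷ B) j)) (∑-extends-within T B j)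

∑-extends : ∀ {n} (T : Subset n) j → ∑ (λ A → 𝟙[ extends? T j A ]) ≡ ∣ ⊤ ─ T ∣ C j
∑-extends T j = begin
  ∑ (λ A → 𝟙[ extends? T j A ])
    ≡⟨ ∑-cong (λ A → 𝟙-×-dec-yes (A ⊆? ⊤) (extends? T j A) ⊆⊤) ⟨
  ∑ (λ A → 𝟙[ A ⊆? ⊤ ×-dec extends? T j A ])  ≡⟨ ∑-extends-within T ⊤ j ⟩
  𝟙[ T ⊆? ⊤ ] * (∣ ⊤ ─ T ∣ C j)               ≡⟨ cong (_* (∣ ⊤ ─ T ∣ C j)) (𝟙-yes (T ⊆? ⊤) ⊆⊤) ⟩
  1 * (∣ ⊤ ─ T ∣ C j)                         ≡⟨ *-identityˡ (∣ ⊤ ─ T ∣ C j) ⟩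
  ∣ ⊤ ─ T ∣ C j                               ∎

blocksThrough : ∀ {n} → List (Subset n) → Subset n → ℕ
blocksThrough I A = ∑ᴸ I (λ B → 𝟙[ A ⊆? B ])

∑-extends-blocksThrough : ∀ {n} (I : List (Subset n)) T j →
  ∑ (λ A → 𝟙[ extends? T j A ] * blocksThrough I A) ≡ ∑ᴸ I (λ B → 𝟙[ T ⊆? B ] * (∣ B ─ T ∣ C j))
∑-extends-blocksThrough I T j = begin
  ∑ (λ A → 𝟙[ extends? T j A ] * blocksThrough I A)
    ≡⟨ ∑-cong (λ A → ∑ᴸ-distribˡ-* I 𝟙[ extends? T j A ] (λ B → 𝟙[ A ⊆? B ])) ⟩
  ∑ (λ A → ∑ᴸ I (λ B → 𝟙[ extends? T j A ] * 𝟙[ A ⊆? B ]))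
    ≡⟨ ∑-cong (λ A → ∑ᴸ-cong I (λ {B} _ → 𝟙*𝟙≡𝟙[×-dec] A B)) ⟩
  ∑ (λ A → ∑ᴸ I (λ B → 𝟙[ A ⊆? B ×-dec extends? T j A ]))
    ≡⟨ ∑-∑ᴸ-comm I (λ A B → 𝟙[ A ⊆? B ×-dec extends? T j A ]) ⟩
  ∑ᴸ I (λ B → ∑ (λ A → 𝟙[ A ⊆? B ×-dec extends? T j A ]))
    ≡⟨ ∑ᴸ-cong I (λ {B} _ → ∑-extends-within T B j) ⟩
  ∑ᴸ I (λ B → 𝟙[ T ⊆? B ] * (∣ B ─ T ∣ C j)) ∎
  where
  𝟙*𝟙≡𝟙[×-dec] : ∀ A B → 𝟙[ extends? T j A ] * 𝟙[ A ⊆? B ] ≡ 𝟙[ A ⊆? B ×-dec extends? T j A ]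
  𝟙*𝟙≡𝟙[×-dec] A B =
    trans (*-comm 𝟙[ extends? T j A ] 𝟙[ A ⊆? B ]) (sym (𝟙[×-dec]≡𝟙*𝟙 (A ⊆? B) (extends? T j A)))

-- For blocks of size k+1 this says that I is a Steiner system S(k, k+1, n).
CoversEachOnce : ∀ {n} → ℕ → List (Subset n) → Set
CoversEachOnce k I = ∀ A → ∣ A ∣ ≡ k → blocksThrough I A ≡ 1

module _ {N k : ℕ} {I : List (Subset N)} (blockSize : All (IsVertex N (suc k)) I) where

  module _ (unique : Unique I)
           (independent : ∀ {s t} → s ∈ I → t ∈ I → ¬ Adjacent N (suc k) s t) where

    blocks⊇k-subset-coincide : ∀ {A B₁ B₂} → ∣ A ∣ ≡ k → B₁ ∈ I → B₂ ∈ I → A ⊆ B₁ → A ⊆ B₂ → B₁ ≡ B₂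
    blocks⊇k-subset-coincide {A} {B₁} {B₂} ∣A∣≡k B₁∈I B₂∈I A⊆B₁ A⊆B₂ =
      [ (λ ∣B₁∩B₂∣<1+k → contradiction (≤-antisym (s≤s⁻¹ ∣B₁∩B₂∣<1+k) k≤∣B₁∩B₂∣)
                                       (independent B₁∈I B₂∈I))
      , (λ ∣B₁∩B₂∣≡1+k → trans (sym (B₁∩B₂≡ (p∩q⊆p B₁ B₂) B₁∈I ∣B₁∩B₂∣≡1+k))
                               (B₁∩B₂≡ (p∩q⊆q B₁ B₂) B₂∈I ∣B₁∩B₂∣≡1+k))
      ]′ (m≤n⇒m<n∨m≡n ∣B₁∩B₂∣≤1+k)
      where
      k≤∣B₁∩B₂∣ : k ≤ ∣ B₁ ∩ B₂ ∣
      k≤∣B₁∩B₂∣ = subst (_≤ ∣ B₁ ∩ B₂ ∣) ∣A∣≡k (p⊆q⇒∣p∣≤∣q∣ (λ x∈A → x∈p∩q⁺ (A⊆B₁ x∈A , A⊆B₂ x∈A)))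
      ∣B₁∩B₂∣≤1+k : ∣ B₁ ∩ B₂ ∣ ≤ suc k
      ∣B₁∩B₂∣≤1+k = subst (∣ B₁ ∩ B₂ ∣ ≤_) (All.lookup blockSize B₁∈I) (∣p∩q∣≤∣p∣ B₁ B₂)
      B₁∩B₂≡ : ∀ {B} → B₁ ∩ B₂ ⊆ B → B ∈ I → ∣ B₁ ∩ B₂ ∣ ≡ suc k → B₁ ∩ B₂ ≡ B
      B₁∩B₂≡ ⊆B B∈I ∣B₁∩B₂∣≡1+k =
        p⊆q⇒∣p∣≡∣q∣⇒p≡q ⊆B (trans ∣B₁∩B₂∣≡1+k (sym (All.lookup blockSize B∈I)))

    blocksThrough≤1 : ∀ {A} → ∣ A ∣ ≡ k → blocksThrough I A ≤ 1
    blocksThrough≤1 {A} ∣A∣≡k = ∑ᴸ-𝟙≤1 (A ⊆?_) unique (blocks⊇k-subset-coincide ∣A∣≡k)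

    independent⇒coversEachOnce : length I * suc k ≡ N C k → CoversEachOnce k I
    independent⇒coversEachOnce |I|[1+k]≡NCk A ∣A∣≡k = begin
      blocksThrough I A      ≡⟨ *-identityˡ (blocksThrough I A) ⟨
      1 * blocksThrough I A  ≡⟨ cong (_* blocksThrough I A) 𝟙[k-set]A≡1 ⟨
      covered A              ≡⟨ pointwise≤∧∑≡⇒≡ {f = covered} {g = 𝟙[k-set]} bounded ∑-equal A ⟩
      𝟙[k-set] A             ≡⟨ 𝟙[k-set]A≡1 ⟩
      1                      ∎
      where
      𝟙[k-set] covered : Subset N → ℕ
      𝟙[k-set] A = 𝟙[ extends? ⊥ k A ]
      covered A = 𝟙[k-set] A * blocksThrough I A

      𝟙[k-set]A≡1 : 𝟙[k-set] A ≡ 1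
      𝟙[k-set]A≡1 = 𝟙-yes (extends? ⊥ k A) (⊥⊆ , trans (cong ∣_∣ (p─⊥≡p A)) ∣A∣≡k)

      bounded : ∀ A → covered A ≤ 𝟙[k-set] A
      bounded A = 𝟙[a]*x≤𝟙[a] (extends? ⊥ k A)
        λ (_ , ∣A─⊥∣≡k) → blocksThrough≤1 {A} (trans (cong ∣_∣ (sym (p─⊥≡p A))) ∣A─⊥∣≡k)

      block-contribution : ∀ {B} → B ∈ I → 𝟙[ ⊥ ⊆? B ] * (∣ B ─ ⊥ ∣ C k) ≡ suc k
      block-contribution {B} B∈I = begin
        𝟙[ ⊥ ⊆? B ] * (∣ B ─ ⊥ ∣ C k)
          ≡⟨ cong₂ (λ x y → x * (∣ y ∣ C k)) (𝟙-yes (⊥ ⊆? B) ⊥⊆) (p─⊥≡p B) ⟩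
        1 * (∣ B ∣ C k)  ≡⟨ *-identityˡ (∣ B ∣ C k) ⟩
        ∣ B ∣ C k        ≡⟨ cong (_C k) (All.lookup blockSize B∈I) ⟩
        suc k C k        ≡⟨ [1+n]Cn≡1+n k ⟩
        suc k            ∎

      ∑-equal : ∑ covered ≡ ∑ 𝟙[k-set]
      ∑-equal = begin
        ∑ covered                                    ≡⟨ ∑-extends-blocksThrough I ⊥ k ⟩
        ∑ᴸ I (λ B → 𝟙[ ⊥ ⊆? B ] * (∣ B ─ ⊥ ∣ C k))   ≡⟨ ∑ᴸ-cong I block-contribution ⟩
        ∑ᴸ I (λ _ → suc k)                           ≡⟨ ∑ᴸ-const I (suc k) ⟩
        length I * suc k                             ≡⟨ |I|[1+k]≡NCk ⟩
        N C k                                        ≡⟨ cong (_C k) ∣⊤─⊥∣≡N ⟨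
        ∣ ⊤ {N} ─ ⊥ ∣ C k                            ≡⟨ ∑-extends (⊥ {N}) k ⟨
        ∑ 𝟙[k-set]                                   ∎
        where
        ∣⊤─⊥∣≡N : ∣ ⊤ {N} ─ ⊥ ∣ ≡ N
        ∣⊤─⊥∣≡N = trans (cong ∣_∣ (p─⊥≡p (⊤ {N}))) (∣⊤∣≡n N)

  coversEachOnce⇒[1+j]∣mCj : CoversEachOnce k I →
    ∀ {i j m} → i + j ≡ k → i + m ≡ N → suc j ∣ m C j
  coversEachOnce⇒[1+j]∣mCj covers {i} {j} {m} i+j≡k i+m≡N =
    subst (suc j ∣_) (sym mCj≡[1+j]*#blocks⊇T) (m∣m*n #blocks⊇T)
    where
    i≤N : i ≤ N
    i≤N = subst (i ≤_) i+m≡N (m≤m+n i m)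

    T : Subset N
    T = proj₁ (subset-of-size i≤N)

    ∣T∣≡i : ∣ T ∣ ≡ i
    ∣T∣≡i = proj₂ (subset-of-size i≤N)

    #blocks⊇T : ℕ
    #blocks⊇T = ∑ᴸ I (λ B → 𝟙[ T ⊆? B ])

    i+∣A─T∣≡∣A∣ : ∀ {A} → T ⊆ A → i + ∣ A ─ T ∣ ≡ ∣ A ∣
    i+∣A─T∣≡∣A∣ {A} T⊆A = trans (cong (_+ ∣ A ─ T ∣) (sym ∣T∣≡i)) (sym (p⊆q⇒∣q∣≡∣p∣+∣q─p∣ T⊆A))

    m≡∣⊤─T∣ : m ≡ ∣ ⊤ ─ T ∣
    m≡∣⊤─T∣ = +-cancelˡ-≡ i m _ (trans i+m≡N (sym (trans (i+∣A─T∣≡∣A∣ {⊤} ⊆⊤) (∣⊤∣≡n N))))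

    through-k-set : ∀ {A} → Extends T j A → blocksThrough I A ≡ 1
    through-k-set {A} (T⊆A , ∣A─T∣≡j) =
      covers A (trans (sym (i+∣A─T∣≡∣A∣ T⊆A)) (trans (cong (i +_) ∣A─T∣≡j) i+j≡k))

    block-contribution : ∀ {B} → B ∈ I → 𝟙[ T ⊆? B ] * (∣ B ─ T ∣ C j) ≡ suc j * 𝟙[ T ⊆? B ]
    block-contribution {B} B∈I with T ⊆? B
    ... | no _    = sym (*-zeroʳ (suc j))
    ... | yes T⊆B = begin
      ∣ B ─ T ∣ C j + 0  ≡⟨ +-identityʳ _ ⟩
      ∣ B ─ T ∣ C j      ≡⟨ cong (_C j) ∣B─T∣≡1+j ⟩
      suc j C j          ≡⟨ [1+n]Cn≡1+n j ⟩
      suc j              ≡⟨ *-identityʳ (suc j) ⟨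
      suc j * 1          ∎
      where
      ∣B─T∣≡1+j : ∣ B ─ T ∣ ≡ suc j
      ∣B─T∣≡1+j = +-cancelˡ-≡ i _ _ (begin
        i + ∣ B ─ T ∣  ≡⟨ i+∣A─T∣≡∣A∣ T⊆B ⟩
        ∣ B ∣          ≡⟨ All.lookup blockSize B∈I ⟩
        suc k          ≡⟨ cong suc i+j≡k ⟨
        suc (i + j)    ≡⟨ +-suc i j ⟨
        i + suc j      ∎)

    mCj≡[1+j]*#blocks⊇T : m C j ≡ suc j * #blocks⊇T
    mCj≡[1+j]*#blocks⊇T = begin
      m C j                                              ≡⟨ cong (_C j) m≡∣⊤─T∣ ⟩
      ∣ ⊤ ─ T ∣ C j                                      ≡⟨ ∑-extends T j ⟨
      ∑ (λ A → 𝟙[ extends? T j A ])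
        ≡⟨ ∑-cong (λ A → 𝟙[a]*x≡𝟙[a] (extends? T j A) through-k-set) ⟨
      ∑ (λ A → 𝟙[ extends? T j A ] * blocksThrough I A)  ≡⟨ ∑-extends-blocksThrough I T j ⟩
      ∑ᴸ I (λ B → 𝟙[ T ⊆? B ] * (∣ B ─ T ∣ C j))         ≡⟨ ∑ᴸ-cong I block-contribution ⟩
      ∑ᴸ I (λ B → suc j * 𝟙[ T ⊆? B ])
        ≡⟨ ∑ᴸ-distribˡ-* I (suc j) (λ B → 𝟙[ T ⊆? B ]) ⟨
      suc j * #blocks⊇T                                  ∎

catalan-independent-set⇒[1+j]∣[2+k+j]Cj : ∀ {k j} (I : List (Subset (2 * suc k))) →
  IsIndependentSet (2 * suc k) (suc k) I → length I ≡ catalan (suc k) →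
  j ≤ k → suc j ∣ (suc (suc k) + j) C j
catalan-independent-set⇒[1+j]∣[2+k+j]Cj {k} {j} I (unique , blockSize , independent) |I|≡C j≤k =
  coversEachOnce⇒[1+j]∣mCj blockSize covers (m∸n+n≡m j≤k) i+m≡2[1+k]
  where
  covers : CoversEachOnce k I
  covers = independent⇒coversEachOnce blockSize unique independent (begin
    length I * suc k         ≡⟨ cong (_* suc k) |I|≡C ⟩
    catalan (suc k) * suc k  ≡⟨ *-comm (catalan (suc k)) (suc k) ⟩
    suc k * catalan (suc k)  ≡⟨ [1+k]*catalan[1+k]≡2[1+k]Ck k ⟩
    (2 * suc k) C k          ∎)

  i+m≡2[1+k] : k ∸ j + (suc (suc k) + j) ≡ 2 * suc k
  i+m≡2[1+k] = begin
    k ∸ j + (suc (suc k) + j)  ≡⟨ cong (k ∸ j +_) (+-comm (suc (suc k)) j) ⟩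
    k ∸ j + (j + suc (suc k))  ≡⟨ +-assoc (k ∸ j) j (suc (suc k)) ⟨
    k ∸ j + j + suc (suc k)    ≡⟨ cong (_+ suc (suc k)) (m∸n+n≡m j≤k) ⟩
    k + suc (suc k)            ≡⟨ +-suc k (suc k) ⟩
    suc (k + suc k)            ≡⟨ cong (λ x → suc (k + suc x)) (+-identityʳ k) ⟨
    2 * suc k                  ∎

proposition4p5 : (k : ℕ) → 1 ≤ k →
    IndependenceNumberIs (2 * k) k (catalan k) → Prime (suc k)
proposition4p5 zero () _
proposition4p5 (suc k) _ ((I , independent , |I|≡catalan) , _) with prime? (suc (suc k))
... | yes prime[2+k] = prime[2+k]
... | no ¬prime[2+k] with ¬prime⇒prime-divisor< ¬prime[2+k]
...   | zero  , p-prime , _ = contradiction p-prime ¬prime[0]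
...   | suc j , p-prime , 1+j<2+k , divides q 2+k≡q[1+j] =
  contradiction (subst (λ n → suc j ∣ (n + j) C j) 2+k≡q[1+j] [1+j]∣[2+k+j]Cj)
                (p∤[qp+r]Cr p-prime q (n<1+n j))
  where
  [1+j]∣[2+k+j]Cj : suc j ∣ (suc (suc k) + j) C j
  [1+j]∣[2+k+j]Cj = catalan-independent-set⇒[1+j]∣[2+k+j]Cj I independent |I|≡catalan
                      (s≤s⁻¹ (s≤s⁻¹ 1+j<2+k))
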